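{- For every $n\ge1$, $|\mathrm{Sort}_n(\mathfrak{s}_{\underline{32}1})|=M_n$, the $n$-th Motzkin number.
   Context: Motzkin numbers $M_n$: $1,1,2,4,9,21,\dots$ for $n=0,1,2,\dots$, counting lattice paths from $(0,0)$ to $(n,0)$ with steps $(1,1),(1,-1),(1,0)$ never going below the $x$-axis. A pattern is a permutation $\sigma$ in which some blocks of consecutive entries may be underlined; a sequence contains it if it has a subsequence order-isomorphic to $\sigma$ whose entries corresponding to a common underlined block are adjacent in the sequence. Pattern-avoiding stack map $\mathfrak{s}_\sigma$: process input $\tau_1,\dots,\tau_n$ in order; when $\tau_i$ is next, while the stack is nonempty and the sequence formed by placing $\tau_i$ on top of the stack, read top to bottom, contains $\sigma$ (underlined entries adjacent in the stack), pop the top entry to the output; then push $\tau_i$; at the end pop all remaining entries top to bottom to the output. West's stack-sorting map $s$ pushes each input entry after popping all smaller stack entries to the output, emptying the stack at the end. $\mathrm{Sort}_n(\mathfrak{s}_\sigma)=\{\tau\in\mathfrak S_n: s(\mathfrak{s}_\sigma(\tau))=12\cdots n\}$. -}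

module Defs where

open import Data.Nat using (ℕ; zero; suc; _+_; _*_; _<ᵇ_; _≟_)
open import Data.Bool using (Bool; true; false; if_then_else_; _∧_; _∨_)
open import Data.List using (List; []; _∷_; _++_; map; concatMap; upTo; filter; length)
open import Data.Bool.ListAction using (any)
open import Data.List.Properties using (≡-dec)
open import Data.Product using (_×_; _,_; proj₁; proj₂)

-- Motzkin numbers via lattice paths: pathsFrom n h = number of paths of n steps
-- U=(1,1), D=(1,-1), F=(1,0) from height h to height 0, never below the x-axis.
pathsFrom : ℕ → ℕ → ℕ
pathsFrom zero zero = 1
pathsFrom zero (suc h) = 0
pathsFrom (suc n) zero = pathsFrom n 1 + pathsFrom n 0
pathsFrom (suc n) (suc h) = pathsFrom n (suc (suc h)) + pathsFrom n (suc h) + pathsFrom n h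

motzkin : ℕ → ℕ
motzkin n = pathsFrom n 0

insertEverywhere : ℕ → List ℕ → List (List ℕ)
insertEverywhere x [] = (x ∷ []) ∷ []
insertEverywhere x (y ∷ ys) = (x ∷ y ∷ ys) ∷ map (y ∷_) (insertEverywhere x ys)

perms : ℕ → List (List ℕ)
perms zero = [] ∷ []
perms (suc n) = concatMap (insertEverywhere (suc n)) (perms n)

idPerm : ℕ → List ℕ
idPerm n = map suc (upTo n)

-- Containment of the pattern 3̲2̲1 (first two entries underlined) in a sequence
-- a₁ a₂ … a_k: there are positions j, j+1, l with l > j+1 and a_j > a_{j+1} > a_l.
contains321u : List ℕ → Bool
contains321u [] = false
contains321u (a ∷ []) = false
contains321u (a ∷ b ∷ rest) =
  ((b <ᵇ a) ∧ any (_<ᵇ b) rest) ∨ contains321u (b ∷ rest)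

-- With next input x and stack (top first): while the stack is nonempty and
-- x placed on top of the stack, read top to bottom, contains 3̲2̲1, pop the top.
popsσ : ℕ → List ℕ → List ℕ × List ℕ
popsσ x [] = [] , []
popsσ x (t ∷ s) with contains321u (x ∷ t ∷ s)
... | true  = let r = popsσ x s in (t ∷ proj₁ r) , proj₂ r
... | false = [] , (t ∷ s)

stackRunσ : List ℕ → List ℕ → List ℕ
stackRunσ stack [] = stack
stackRunσ stack (x ∷ xs) =
  let r = popsσ x stack in proj₁ r ++ stackRunσ (x ∷ proj₂ r) xs

sσ : List ℕ → List ℕ
sσ τ = stackRunσ [] τ

popsW : ℕ → List ℕ → List ℕ × List ℕ
popsW x [] = [] , []
popsW x (t ∷ s) with t <ᵇ x
... | true  = let r = popsW x s in (t ∷ proj₁ r) , proj₂ r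
... | false = [] , (t ∷ s)

stackRunW : List ℕ → List ℕ → List ℕ
stackRunW stack [] = stack
stackRunW stack (x ∷ xs) =
  let r = popsW x stack in proj₁ r ++ stackRunW (x ∷ proj₂ r) xs

westSort : List ℕ → List ℕ
westSort τ = stackRunW [] τ

Sortσ : ℕ → List (List ℕ)
Sortσ n = filter (λ τ → ≡-dec _≟_ (westSort (sσ τ)) (idPerm n)) (perms n)

-- Every permutation of length n + 1 arises from one of length n by inserting the maximum N = n + 1,
-- say as α N β. Inserting N in front changes neither what 𝔰 = 𝔰_{3̲2̲1} pops nor how s sorts its
-- output, except that N comes out last. Otherwise let a be the last entry of α: the child is
-- sortable iff the parent α β is and a separates, i.e. a is the minimum of α and exceeds every
-- entry of β; the converse needs that 𝔰 pops nothing from a sortable permutation before its input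
-- ends. Labelling a sortable permutation by its number c of separators, its sortable children are
-- labelled c + 1 (front) and 0, 1, …, c − 1 (after the separators): the generating tree of the
-- Motzkin numbers, whose subtrees are counted by lattice paths.
module Submission where

open import Defs
open import Data.Nat using (ℕ; _≤_)
open import Data.List using (length)
open import Relation.Binary.PropositionalEquality using (_≡_)

open import Data.Bool using (Bool; true; false; if_then_else_; _∧_; _∨_)
open import Data.Bool.ListAction using (any)
open import Data.Bool.Properties using (if-eta; ∨-identityʳ; ∨-zeroʳ; ∧-zeroʳ)
open import Data.List
  using (List; []; _∷_; _++_; [_]; _∷ʳ_; map; concat; filter; upTo; initLast; _∷ʳ′_)
open import Data.List.Properties
  using ( ≡-dec; ++-assoc; ++-identityʳ; ++-conicalˡ; ∷ʳ-injectiveˡ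
        ; map-++; map-∘; map-cong; map-cong-local; upTo-∷ʳ )
open import Data.List.Extrema.Nat using (min; min≤xs; argmin-sel)
open import Data.List.Membership.Propositional using (_∈_)
open import Data.List.Membership.Propositional.Properties using (∈-++⁺ˡ; ∈-++⁺ʳ; ∈-++⁻)
open import Data.List.Relation.Binary.Permutation.Propositional
  using (_↭_; ↭-sym; ↭-trans; ↭-reflexive; module PermutationReasoning)
open import Data.List.Relation.Binary.Permutation.Propositional.Properties
  using (++⁺ˡ; shift; drop-∷; ∷↭∷ʳ; All-resp-↭; ∈-resp-↭)
open import Data.List.Relation.Unary.All using (All; []; _∷_)
import Data.List.Relation.Unary.All as All
open import Data.List.Relation.Unary.All.Properties
  using (++⁺; ++⁻ˡ; ++⁻ʳ; ∷ʳ⁺; map⁺; concat⁺; All¬⇒¬Any)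
open import Data.List.Relation.Unary.AllPairs using (AllPairs; _∷_)
import Data.List.Relation.Unary.AllPairs.Properties as AllPairs
open import Data.List.Relation.Unary.Any using (Any; here; there)
import Data.List.Relation.Unary.Any.Properties as Any
open import Data.Nat using (zero; suc; _+_; _<_; _<ᵇ_; _≟_; _<?_; _≤?_; s≤s)
open import Data.Nat.ListAction using (sum)
open import Data.Nat.ListAction.Properties using (sum-++)
open import Data.Nat.Properties
  using (+-comm; +-identityʳ; +-suc; ≤-refl; <⇒≤; ≮⇒≥; ≤⇒≯; <⇒≯; <⇒≱; m<n⇒m<1+n)
open import Data.Nat.Tactic.RingSolver using (solve-∀)
open import Data.Empty using (⊥-elim)
open import Data.Product using (_×_; _,_; proj₁; proj₂)
open import Data.Sum using (inj₁; inj₂)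
open import Function using (case_of_)
open import Function.Bundles using (_⇔_; mk⇔; Equivalence)
open import Relation.Binary.PropositionalEquality
  using (refl; sym; trans; cong; cong₂; subst; module ≡-Reasoning)
open import Relation.Nullary using (¬_; yes; no)
open import Relation.Nullary.Decidable using (Dec; does; dec-true; dec-false; does-⇔; _×-dec_)

-- Lattice paths

sumBelow : ℕ → (ℕ → ℕ) → ℕ
sumBelow zero    f = 0
sumBelow (suc c) f = sumBelow c f + f c

-- The number of paths of c + d steps from height h to height 0 whose first c steps are up- or flat steps.
risingPaths : ℕ → ℕ → ℕ → ℕ
risingPaths zero    h d = pathsFrom d h
risingPaths (suc c) h d = risingPaths c (suc h) d + risingPaths c h d

risingPaths-to-0 : ∀ c h → risingPaths c (suc h) 0 ≡ 0
risingPaths-to-0 zero    h = refl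
risingPaths-to-0 (suc c) h rewrite risingPaths-to-0 c (suc h) | risingPaths-to-0 c h = refl

risingPaths-empty : ∀ c → risingPaths c 0 0 ≡ 1
risingPaths-empty zero    = refl
risingPaths-empty (suc c) rewrite risingPaths-to-0 c 0 = risingPaths-empty c

-- Classify the paths by the position of the first up-step among the first c steps.
risingPaths-unroll : ∀ c h d →
  risingPaths c h d ≡ pathsFrom d h + sumBelow c (λ j → risingPaths j (suc h) d)
risingPaths-unroll zero    h d = sym (+-identityʳ _)
risingPaths-unroll (suc c) h d rewrite risingPaths-unroll c h d =
  rotate (risingPaths c (suc h) d) (pathsFrom d h) (sumBelow c (λ j → risingPaths j (suc h) d))
  where
  rotate : ∀ a b s → a + (b + s) ≡ b + (s + a)
  rotate = solve-∀

downFirstPaths : ℕ → ℕ → ℕ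
downFirstPaths zero    d = 0
downFirstPaths (suc h) d = pathsFrom d h

risingPaths-suc : ∀ c h d → risingPaths c h (suc d) ≡
  risingPaths (suc c) h d + sumBelow c (λ j → risingPaths j h d) + downFirstPaths h d
risingPaths-suc zero    zero    d = sym (trans (+-identityʳ _) (+-identityʳ _))
risingPaths-suc zero    (suc h) d = cong (_+ pathsFrom d h) (sym (+-identityʳ _))
risingPaths-suc (suc c) h       d = begin
    risingPaths c (suc h) (suc d) + risingPaths c h (suc d)
  ≡⟨ cong₂ _+_ (risingPaths-suc c (suc h) d) (risingPaths-suc c h d) ⟩
    (A + S₁ + pathsFrom d h) + (B + S₀ + downFirstPaths h d)
  ≡⟨ regroup A S₁ (pathsFrom d h) B S₀ (downFirstPaths h d) ⟩
    (A + B) + (S₀ + (pathsFrom d h + S₁)) + downFirstPaths h d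
  ≡⟨ cong (λ r → (A + B) + (S₀ + r) + downFirstPaths h d) (sym (risingPaths-unroll c h d)) ⟩
    risingPaths (suc (suc c)) h d + sumBelow (suc c) (λ j → risingPaths j h d) + downFirstPaths h d
  ∎
  where
  open ≡-Reasoning
  A B S₀ S₁ : ℕ
  A  = risingPaths (suc c) (suc h) d
  B  = risingPaths (suc c) h d
  S₀ = sumBelow c (λ j → risingPaths j h d)
  S₁ = sumBelow c (λ j → risingPaths j (suc h) d)
  regroup : ∀ a s₁ p b s₀ e → (a + s₁ + p) + (b + s₀ + e) ≡ (a + b) + (s₀ + (p + s₁)) + e
  regroup = solve-∀

-- The generating tree of the Motzkin numbers: a node labelled c has children labelled
-- c + 1, 0, 1, …, c − 1.
risingPaths-children : ∀ c d →
  risingPaths c 0 (suc d) ≡ risingPaths (suc c) 0 d + sumBelow c (λ j → risingPaths j 0 d)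
risingPaths-children c d = trans (risingPaths-suc c 0 d) (+-identityʳ _)

-- Stack machines

<ᵇ-true : ∀ {m n} → m < n → (m <ᵇ n) ≡ true
<ᵇ-true = dec-true (_ <? _)

<ᵇ-false : ∀ {m n} → ¬ m < n → (m <ᵇ n) ≡ false
<ᵇ-false = dec-false (_ <? _)

record Config : Set where
  constructor _⟫_
  field
    output : List ℕ
    stack  : List ℕ
open Config

flush : Config → List ℕ
flush c = output c ++ stack c

emit : List ℕ → Config → Config
emit o c = (o ++ output c) ⟫ stack c

_atop_ : Config → List ℕ → Config
c atop B = output c ⟫ (stack c ++ B)

flush-emit : ∀ o c → flush (emit o c) ≡ o ++ flush c
flush-emit o c = ++-assoc o (output c) (stack c)

flush-atop : ∀ c B → flush (c atop B) ≡ flush c ++ B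
flush-atop c B = sym (++-assoc (output c) (stack c) B)

-- Whether to pop the top entry t, given the entries s below it and the incoming entry x.
PopRule : Set
PopRule = ℕ → List ℕ → ℕ → Bool

pops : PopRule → ℕ → List ℕ → Config
pops pop? x []      = [] ⟫ []
pops pop? x (t ∷ s) = if pop? t s x then emit [ t ] (pops pop? x s) else [] ⟫ (t ∷ s)

run : PopRule → List ℕ → List ℕ → Config
run pop? st []       = [] ⟫ st
run pop? st (x ∷ xs) = let c = pops pop? x st in emit (output c) (run pop? (x ∷ stack c) xs)

module _ (pop? : PopRule) where

  pops-flush : ∀ x st → flush (pops pop? x st) ≡ st
  pops-flush x []      = refl
  pops-flush x (t ∷ s) with pop? t s x
  ... | true  = cong (t ∷_) (pops-flush x s)
  ... | false = refl

  pops-none : ∀ x st → output (pops pop? x st) ≡ [] → pops pop? x st ≡ [] ⟫ st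
  pops-none x []      _ = refl
  pops-none x (t ∷ s) e with pop? t s x
  pops-none x (t ∷ s) () | true
  ... | false = refl

  pops-none-top : ∀ x t s → output (pops pop? x (t ∷ s)) ≡ [] → pop? t s x ≡ false
  pops-none-top x t s e with pop? t s x
  pops-none-top x t s () | true
  ... | false = refl

  pops-stop : ∀ x t s → pop? t s x ≡ false → output (pops pop? x (t ∷ s)) ≡ []
  pops-stop x t s e rewrite e = refl

  All-stack-pops : ∀ {P : ℕ → Set} x {st} → All P st → All P (stack (pops pop? x st))
  All-stack-pops x {st} Pst = ++⁻ʳ (output (pops pop? x st)) (subst (All _) (sym (pops-flush x st)) Pst)

  run-++ : ∀ st xs ys →
    run pop? st (xs ++ ys) ≡ emit (output (run pop? st xs)) (run pop? (stack (run pop? st xs)) ys)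
  run-++ st []       ys = refl
  run-++ st (x ∷ xs) ys =
    trans (cong (emit (output c)) (run-++ (x ∷ stack c) xs ys))
          (cong (_⟫ stack (run pop? (stack r) ys)) (sym (++-assoc (output c) (output r) _)))
    where
    c r : Config
    c = pops pop? x st
    r = run pop? (x ∷ stack c) xs

  run-↭ : ∀ st xs → flush (run pop? st xs) ↭ st ++ xs
  run-↭ st []       = ↭-reflexive (sym (++-identityʳ st))
  run-↭ st (x ∷ xs) = begin
      (output c ++ output r) ++ stack r  ≡⟨ ++-assoc (output c) _ _ ⟩
      output c ++ flush r                ↭⟨ ++⁺ˡ (output c) (run-↭ (x ∷ stack c) xs) ⟩
      output c ++ x ∷ stack c ++ xs      ↭⟨ ++⁺ˡ (output c) (↭-sym (shift x (stack c) xs)) ⟩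
      output c ++ stack c ++ x ∷ xs      ≡⟨ sym (++-assoc (output c) _ _) ⟩
      flush c ++ x ∷ xs                  ≡⟨ cong (_++ x ∷ xs) (pops-flush x st) ⟩
      st ++ x ∷ xs                       ∎
    where
    open PermutationReasoning
    c r : Config
    c = pops pop? x st
    r = run pop? (x ∷ stack c) xs

  All-flush-run : ∀ {P : ℕ → Set} st xs → All P (st ++ xs) → All P (flush (run pop? st xs))
  All-flush-run st xs = All-resp-↭ (↭-sym (run-↭ st xs))

-- A bottom part B of the stack that no incoming entry pops is never exposed; the rule r
-- then acts on the entries above B as the rule r′ does on a stack without B.
module _ {r r′ : PopRule} {P : ℕ → Set} {B : List ℕ}
         (rule-atop : ∀ {t} s x → P t → r t (s ++ B) x ≡ r′ t s x) where

  pops-atop : ∀ {x} → output (pops r x B) ≡ [] → ∀ U → All P U →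
    pops r x (U ++ B) ≡ pops r′ x U atop B
  pops-atop {x} blocked []      []        = pops-none r x B blocked
  pops-atop {x} blocked (t ∷ s) (Pt ∷ Ps) rewrite rule-atop s x Pt with r′ t s x
  ... | true  = cong (emit [ t ]) (pops-atop blocked s Ps)
  ... | false = refl

  run-atop : ∀ U xs → All P U → All P xs → All (λ x → output (pops r x B) ≡ []) xs →
    run r (U ++ B) xs ≡ run r′ U xs atop B
  run-atop U []       _  _          _          = refl
  run-atop U (x ∷ xs) PU (Px ∷ Pxs) (bx ∷ bxs) rewrite pops-atop bx U PU =
    cong (emit _) (run-atop (x ∷ stack (pops r′ x U)) xs (Px ∷ All-stack-pops r′ x PU) Pxs bxs)

-- West's stack-sorting map

westRule : PopRule
westRule t _ x = t <ᵇ x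

popsW-pops : ∀ x st → popsW x st ≡ (output (pops westRule x st) , stack (pops westRule x st))
popsW-pops x []      = refl
popsW-pops x (t ∷ s) with t <ᵇ x
... | true  rewrite popsW-pops x s = refl
... | false = refl

stackRunW-run : ∀ st xs → stackRunW st xs ≡ flush (run westRule st xs)
stackRunW-run st []       = refl
stackRunW-run st (x ∷ xs) rewrite popsW-pops x st | stackRunW-run (x ∷ stack (pops westRule x st)) xs =
  sym (++-assoc (output (pops westRule x st)) _ _)

westSort-run : ∀ L → westSort L ≡ flush (run westRule [] L)
westSort-run = stackRunW-run []

westSort-↭ : ∀ L → westSort L ↭ L
westSort-↭ L = subst (_↭ L) (sym (westSort-run L)) (run-↭ westRule [] L)

pops-west-smaller : ∀ x st → All (_< x) st → pops westRule x st ≡ st ⟫ []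
pops-west-smaller x []      []          = refl
pops-west-smaller x (t ∷ s) (t<x ∷ s<x) rewrite <ᵇ-true t<x | pops-west-smaller x s s<x = refl

westSort-split : ∀ Z s S → All (_< s) Z → westSort (Z ++ s ∷ S) ≡ westSort Z ++ westSort (s ∷ S)
westSort-split Z s S Z<s = begin
    westSort (Z ++ s ∷ S)
      ≡⟨ trans (westSort-run (Z ++ s ∷ S)) (cong flush (run-++ westRule [] Z (s ∷ S))) ⟩
    flush (emit (output rZ) (run westRule (stack rZ) (s ∷ S)))
      ≡⟨ cong (λ c → flush (emit (output rZ) (emit (output c) (run westRule (s ∷ stack c) S))))
              (pops-west-smaller s (stack rZ) stack<s) ⟩
    flush (emit (output rZ) (emit (stack rZ) rS))
      ≡⟨ trans (flush-emit (output rZ) _) (cong (output rZ ++_) (flush-emit (stack rZ) rS)) ⟩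
    output rZ ++ stack rZ ++ flush rS
      ≡⟨ sym (++-assoc (output rZ) _ _) ⟩
    flush rZ ++ flush rS
      ≡⟨ sym (cong₂ _++_ (westSort-run Z) (westSort-run (s ∷ S))) ⟩
    westSort Z ++ westSort (s ∷ S)
    ∎
  where
  open ≡-Reasoning
  rZ rS : Config
  rZ = run westRule [] Z
  rS = run westRule [ s ] S
  stack<s : All (_< s) (stack rZ)
  stack<s = ++⁻ʳ (output rZ) (All-flush-run westRule [] Z Z<s)

westSort-max-first : ∀ N S → All (_< N) S → westSort (N ∷ S) ≡ westSort S ++ [ N ]
westSort-max-first N S S<N = begin
    westSort (N ∷ S)                     ≡⟨ westSort-run (N ∷ S) ⟩
    flush (run westRule ([] ++ [ N ]) S)
      ≡⟨ cong flush (run-atop (λ _ _ _ → refl) [] S [] S<N (All.map blocked S<N)) ⟩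
    flush (run westRule [] S atop [ N ]) ≡⟨ flush-atop (run westRule [] S) [ N ] ⟩
    flush (run westRule [] S) ++ [ N ]   ≡⟨ cong (_++ [ N ]) (sym (westSort-run S)) ⟩
    westSort S ++ [ N ]                  ∎
  where
  open ≡-Reasoning
  blocked : ∀ {x} → x < N → output (pops westRule x [ N ]) ≡ []
  blocked x<N rewrite <ᵇ-false (<⇒≯ x<N) = refl

westSort-around-max : ∀ Z N S → All (_< N) Z → All (_< N) S →
  westSort (Z ++ N ∷ S) ≡ westSort Z ++ westSort S ++ [ N ]
westSort-around-max Z N S Z<N S<N =
  trans (westSort-split Z N S Z<N) (cong (westSort Z ++_) (westSort-max-first N S S<N))

idPerm-suc : ∀ n → idPerm (suc n) ≡ idPerm n ++ [ suc n ]
idPerm-suc n = trans (cong (map suc) (sym (upTo-∷ʳ n))) (map-++ suc (upTo n) [ n ])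

idPerm-increasing : ∀ n → AllPairs _<_ (idPerm n)
idPerm-increasing n = AllPairs.map⁺ (AllPairs.applyUpTo⁺₁ (λ i → i) n (λ i<j _ → s≤s i<j))

AllPairs-++-across : ∀ {A : Set} {R : A → A → Set} {xs ys x y} →
  AllPairs R (xs ++ ys) → x ∈ xs → y ∈ ys → R x y
AllPairs-++-across {xs = _ ∷ xs} (Rx ∷ _) (here refl) y∈ = All.lookup (++⁻ʳ xs Rx) y∈
AllPairs-++-across (_ ∷ Rxs) (there x∈) y∈ = AllPairs-++-across Rxs x∈ y∈

-- The pattern-avoiding stack map 𝔰

-- The rule of 𝔰 on a stack whose never exposed bottom part is `floor`: pop t when the
-- incoming x, t and a smaller entry further down form the pattern 3̲2̲1.
avoidRule : List ℕ → PopRule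
avoidRule floor t s x = (t <ᵇ x) ∧ (any (_<ᵇ t) floor ∨ any (_<ᵇ t) s)

σ : PopRule
σ = avoidRule []

Avoids : List ℕ → Set
Avoids s = contains321u s ≡ false

avoids-tail : ∀ t s → Avoids (t ∷ s) → Avoids s
avoids-tail t []      _  = refl
avoids-tail t (u ∷ s) av with (u <ᵇ t) ∧ any (_<ᵇ u) s
... | false = av

-- On a stack avoiding the pattern, an occurrence of it after pushing x must involve x.
contains-push : ∀ x t s → Avoids (t ∷ s) → contains321u (x ∷ t ∷ s) ≡ σ t s x
contains-push x t s av rewrite av = ∨-identityʳ _

popsσ-pops : ∀ x st → Avoids st → popsσ x st ≡ (output (pops σ x st) , stack (pops σ x st))
popsσ-pops x []      _  = refl
popsσ-pops x (t ∷ s) av with contains321u (x ∷ t ∷ s) | contains-push x t s av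
... | true  | e rewrite sym e | popsσ-pops x s (avoids-tail t s av) = refl
... | false | e rewrite sym e = refl

avoids-push : ∀ x st → Avoids st → Avoids (x ∷ stack (pops σ x st))
avoids-push x []      _  = refl
avoids-push x (t ∷ s) av with σ t s x in e
... | true  = avoids-push x s (avoids-tail t s av)
... | false = trans (contains-push x t s av) e

stackRunσ-run : ∀ st xs → Avoids st → stackRunσ st xs ≡ flush (run σ st xs)
stackRunσ-run st []       _  = refl
stackRunσ-run st (x ∷ xs) av
  rewrite popsσ-pops x st av | stackRunσ-run (x ∷ stack (pops σ x st)) xs (avoids-push x st av) =
  sym (++-assoc (output (pops σ x st)) _ _)

sσ-run : ∀ τ → sσ τ ≡ flush (run σ [] τ)
sσ-run τ = stackRunσ-run [] τ refl

sσ-↭ : ∀ τ → sσ τ ↭ τ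
sσ-↭ τ = subst (_↭ τ) (sym (sσ-run τ)) (run-↭ σ [] τ)

any-<ᵇ-++ : ∀ t s B → any (_<ᵇ t) (s ++ B) ≡ any (_<ᵇ t) B ∨ any (_<ᵇ t) s
any-<ᵇ-++ t []      B = sym (∨-identityʳ _)
any-<ᵇ-++ t (u ∷ s) B with u <ᵇ t
... | true  = sym (∨-zeroʳ _)
... | false = any-<ᵇ-++ t s B

any-<ᵇ≡false : ∀ {t s} → All (t ≤_) s → any (_<ᵇ t) s ≡ false
any-<ᵇ≡false []          = refl
any-<ᵇ≡false (t≤u ∷ t≤s) rewrite <ᵇ-false (≤⇒≯ t≤u) = any-<ᵇ≡false t≤s

any-<ᵇ≡false⇒≥ : ∀ t s → any (_<ᵇ t) s ≡ false → All (t ≤_) s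
any-<ᵇ≡false⇒≥ t []      _ = []
any-<ᵇ≡false⇒≥ t (u ∷ s) e with u <? t
... | yes u<t rewrite <ᵇ-true u<t = case e of λ ()
... | no  u≮t rewrite <ᵇ-false u≮t = ≮⇒≥ u≮t ∷ any-<ᵇ≡false⇒≥ t s e

σ-atop : ∀ B {t} s x → σ t (s ++ B) x ≡ avoidRule B t s x
σ-atop B {t} s x = cong ((t <ᵇ x) ∧_) (any-<ᵇ-++ t s B)

avoidRule-max : ∀ {N t} B s x → t ≤ N → avoidRule (N ∷ B) t s x ≡ avoidRule B t s x
avoidRule-max B s x t≤N rewrite <ᵇ-false (≤⇒≯ t≤N) = refl

σ-blocked : ∀ {b x} B → ¬ b < x → output (pops σ x (b ∷ B)) ≡ []
σ-blocked B b≮x rewrite <ᵇ-false b≮x = refl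

run-σ-under : ∀ b B xs → All (_< b) xs →
  run σ (b ∷ B) xs ≡ run (avoidRule (b ∷ B)) [] xs atop (b ∷ B)
run-σ-under b B xs xs<b =
  run-atop (λ s x _ → σ-atop (b ∷ B) s x)
           [] xs [] xs<b (All.map (λ x<b → σ-blocked B (<⇒≯ x<b)) xs<b)

run-σ-under-max : ∀ N B xs → All (_< N) xs →
  run σ (N ∷ B) xs ≡ run (avoidRule B) [] xs atop (N ∷ B)
run-σ-under-max N B xs xs<N =
  run-atop (λ s x t<N → trans (σ-atop (N ∷ B) s x) (avoidRule-max B s x (<⇒≤ t<N)))
           [] xs [] xs<N (All.map (λ x<N → σ-blocked B (<⇒≯ x<N)) xs<N)

σ-keeps-min : ∀ {t s} x → All (t ≤_) s → σ t s x ≡ false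
σ-keeps-min {t} x t≤s rewrite any-<ᵇ≡false t≤s = ∧-zeroʳ (t <ᵇ x)

pops-keeps-min : ∀ x st {μ} → μ ∈ st → All (μ ≤_) st → μ ∈ stack (pops σ x st)
pops-keeps-min x (t ∷ s) (here refl) (_ ∷ μ≤s) rewrite σ-keeps-min x μ≤s = here refl
pops-keeps-min x (t ∷ s) (there μ∈s) (_ ∷ μ≤s) with σ t s x
... | true  = pops-keeps-min x s μ∈s μ≤s
... | false = there μ∈s

run-keeps-min : ∀ st xs {μ} → μ ∈ st ++ xs → All (μ ≤_) (st ++ xs) →
  μ ∈ stack (run σ st xs)
run-keeps-min st []       μ∈ _  = subst (_ ∈_) (++-identityʳ st) μ∈
run-keeps-min st (x ∷ xs) {μ} μ∈ μ≤ =
  run-keeps-min (x ∷ stack c) xs (moved (∈-++⁻ st μ∈))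
                (All.head μ≤x∷xs ∷ ++⁺ (All-stack-pops σ x μ≤st) (All.tail μ≤x∷xs))
  where
  c : Config
  c = pops σ x st
  μ≤st : All (μ ≤_) st
  μ≤st = ++⁻ˡ st μ≤
  μ≤x∷xs : All (μ ≤_) (x ∷ xs)
  μ≤x∷xs = ++⁻ʳ st μ≤
  moved : _ → μ ∈ (x ∷ stack c) ++ xs
  moved (inj₁ μ∈st)         = there (∈-++⁺ˡ (pops-keeps-min x st μ∈st μ≤st))
  moved (inj₂ (here refl))  = here refl
  moved (inj₂ (there μ∈xs)) = there (∈-++⁺ʳ (stack c) μ∈xs)

-- Inserting a new maximum

Sortable : ℕ → List ℕ → Set
Sortable n τ = westSort (sσ τ) ≡ idPerm n

PopFree : List ℕ → Set
PopFree τ = output (run σ [] τ) ≡ []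

record Quiet (N : ℕ) (τ τ′ : List ℕ) : Set where
  constructor quiet
  field
    same-output : output (run σ [] τ′) ≡ output (run σ [] τ)
    max-last    : westSort (sσ τ′) ≡ westSort (sσ τ) ++ [ N ]

quiet-sortable : ∀ {n τ τ′} → Quiet (suc n) τ τ′ → Sortable (suc n) τ′ ⇔ Sortable n τ
quiet-sortable {n} (quiet _ west) = mk⇔
  (λ sorted′ → ∷ʳ-injectiveˡ _ _ (trans (sym west) (trans sorted′ (idPerm-suc n))))
  (λ sorted → trans west (trans (cong (_++ [ suc n ]) sorted) (sym (idPerm-suc n))))

quiet-popFree : ∀ {N τ τ′} → Quiet N τ τ′ → PopFree τ → PopFree τ′
quiet-popFree (quiet same _) popFree = trans same popFree

quiet-front : ∀ N β → All (_< N) β → Quiet N β (N ∷ β)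
quiet-front N β β<N = quiet (cong output run-Nβ) (begin
    westSort (sσ (N ∷ β))
      ≡⟨ cong westSort (trans (sσ-run (N ∷ β)) (cong flush run-Nβ)) ⟩
    westSort (flush (run σ [] β atop [ N ]))
      ≡⟨ cong westSort (flush-atop (run σ [] β) [ N ]) ⟩
    westSort (flush (run σ [] β) ++ [ N ])
      ≡⟨ cong (λ l → westSort (l ++ [ N ])) (sym (sσ-run β)) ⟩
    westSort (sσ β ++ [ N ])
      ≡⟨ westSort-around-max (sσ β) N [] (All-resp-↭ (↭-sym (sσ-↭ β)) β<N) [] ⟩
    westSort (sσ β) ++ [ N ]
    ∎)
  where
  open ≡-Reasoning
  run-Nβ : run σ [] (N ∷ β) ≡ run σ [] β atop [ N ]
  run-Nβ = run-σ-under-max N [] β β<N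

Separator : List ℕ → ℕ → List ℕ → Set
Separator pre a post = All (a ≤_) pre × All (_< a) post

≥∧<⇒[] : ∀ {μ xs} → All (μ ≤_) xs → All (_< μ) xs → xs ≡ []
≥∧<⇒[] {xs = []}    _         _         = refl
≥∧<⇒[] {xs = _ ∷ _} (μ≤x ∷ _) (x<μ ∷ _) = ⊥-elim (<⇒≱ x<μ μ≤x)

module InsertAfter (n : ℕ) (α₀ : List ℕ) (a : ℕ) (β : List ℕ)
                   (α<N : All (_< suc n) (α₀ ∷ʳ a)) (β<N : All (_< suc n) β) where

  N : ℕ
  N = suc n

  α rest Z : List ℕ
  rα atN rβ : Config
  α    = α₀ ∷ʳ a
  rα   = run σ [] α
  rest = stack (pops σ a (stack (run σ [] α₀)))
  atN  = pops σ N (stack rα)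
  rβ   = run (avoidRule (stack atN)) [] β
  Z    = output rα ++ output atN ++ flush rβ

  a∈α : a ∈ α
  a∈α = ∈-++⁺ʳ α₀ (here refl)

  stack-rα : stack rα ≡ a ∷ rest
  stack-rα = cong stack (run-++ σ [] α₀ [ a ])

  stack-atN : output atN ≡ [] → stack atN ≡ a ∷ rest
  stack-atN T≡[] = trans (cong stack (pops-none σ N (stack rα) T≡[])) stack-rα

  All-α : ∀ {P : ℕ → Set} → All P α →
    All P (output rα) × All P (output atN) × All P (stack atN)
  All-α Pα = ++⁻ˡ (output rα) P-all , ++⁻ˡ (output atN) P-atN , ++⁻ʳ (output atN) P-atN
    where
    α↭ : output rα ++ output atN ++ stack atN ↭ α
    α↭ = subst (_↭ α) (cong (output rα ++_) (sym (pops-flush σ N (stack rα)))) (run-↭ σ [] α)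
    P-all : All _ (output rα ++ output atN ++ stack atN)
    P-all = All-resp-↭ (↭-sym α↭) Pα
    P-atN : All _ (output atN ++ stack atN)
    P-atN = ++⁻ʳ (output rα) P-all

  All-rβ : ∀ {P : ℕ → Set} → All P β → All P (flush rβ)
  All-rβ = All-flush-run (avoidRule (stack atN)) [] β

  run-τ′ : run σ [] (α ++ N ∷ β) ≡ emit (output rα) (emit (output atN) (rβ atop (N ∷ stack atN)))
  run-τ′ = trans (run-++ σ [] α (N ∷ β))
                 (cong (λ c → emit (output rα) (emit (output atN) c))
                       (run-σ-under-max N (stack atN) β β<N))

  sσ-τ′ : sσ (α ++ N ∷ β) ≡ Z ++ N ∷ stack atN
  sσ-τ′ = begin
      sσ (α ++ N ∷ β)
    ≡⟨ trans (sσ-run (α ++ N ∷ β)) (cong flush run-τ′) ⟩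
      flush (emit (output rα) (emit (output atN) (rβ atop (N ∷ stack atN))))
    ≡⟨ trans (flush-emit (output rα) _) (cong (output rα ++_) (flush-emit (output atN) _)) ⟩
      output rα ++ output atN ++ flush (rβ atop (N ∷ stack atN))
    ≡⟨ cong (λ l → output rα ++ output atN ++ l) (flush-atop rβ (N ∷ stack atN)) ⟩
      output rα ++ output atN ++ flush rβ ++ N ∷ stack atN
    ≡⟨ cong (output rα ++_) (sym (++-assoc (output atN) (flush rβ) _)) ⟩
      output rα ++ (output atN ++ flush rβ) ++ N ∷ stack atN
    ≡⟨ sym (++-assoc (output rα) _ _) ⟩
      Z ++ N ∷ stack atN
    ∎
    where open ≡-Reasoning

  westSort-τ′ : westSort (sσ (α ++ N ∷ β)) ≡ (westSort Z ++ westSort (stack atN)) ++ [ N ]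
  westSort-τ′ = begin
      westSort (sσ (α ++ N ∷ β))                    ≡⟨ cong westSort sσ-τ′ ⟩
      westSort (Z ++ N ∷ stack atN)                 ≡⟨ westSort-around-max Z N (stack atN) Z<N S<N ⟩
      westSort Z ++ westSort (stack atN) ++ [ N ]   ≡⟨ sym (++-assoc (westSort Z) _ _) ⟩
      (westSort Z ++ westSort (stack atN)) ++ [ N ] ∎
    where
    open ≡-Reasoning
    Z<N : All (_< N) Z
    Z<N = let (o<N , t<N , _) = All-α α<N in ++⁺ o<N (++⁺ t<N (All-rβ β<N))
    S<N : All (_< N) (stack atN)
    S<N = proj₂ (proj₂ (All-α α<N))

  nothing-popped⇒quiet : output rα ≡ [] → output atN ≡ [] → All (_< a) β →
    Quiet N (α ++ β) (α ++ N ∷ β)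
  nothing-popped⇒quiet oα≡[] T≡[] β<a = quiet same-output max-last
    where
    open ≡-Reasoning
    run-τ : run σ [] (α ++ β) ≡ emit (output rα) (rβ atop (a ∷ rest))
    run-τ = begin
        run σ [] (α ++ β)
          ≡⟨ run-++ σ [] α β ⟩
        emit (output rα) (run σ (stack rα) β)
          ≡⟨ cong (λ st → emit (output rα) (run σ st β)) stack-rα ⟩
        emit (output rα) (run σ (a ∷ rest) β)
          ≡⟨ cong (emit (output rα)) (run-σ-under a rest β β<a) ⟩
        emit (output rα) (run (avoidRule (a ∷ rest)) [] β atop (a ∷ rest))
          ≡⟨ cong (λ F → emit (output rα) (run (avoidRule F) [] β atop (a ∷ rest)))
                  (sym (stack-atN T≡[])) ⟩
        emit (output rα) (rβ atop (a ∷ rest))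
        ∎
    same-output : output (run σ [] (α ++ N ∷ β)) ≡ output (run σ [] (α ++ β))
    same-output = begin
        output (run σ [] (α ++ N ∷ β))       ≡⟨ cong output run-τ′ ⟩
        output rα ++ output atN ++ output rβ ≡⟨ cong (λ T → output rα ++ T ++ output rβ) T≡[] ⟩
        output rα ++ output rβ               ≡⟨ cong output (sym run-τ) ⟩
        output (run σ [] (α ++ β))           ∎
    sσ-τ : sσ (α ++ β) ≡ flush rβ ++ a ∷ rest
    sσ-τ = begin
        sσ (α ++ β)                                   ≡⟨ trans (sσ-run (α ++ β)) (cong flush run-τ) ⟩
        flush (emit (output rα) (rβ atop (a ∷ rest))) ≡⟨ flush-emit (output rα) _ ⟩
        output rα ++ flush (rβ atop (a ∷ rest))       ≡⟨ cong (_++ flush (rβ atop (a ∷ rest))) oα≡[] ⟩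
        flush (rβ atop (a ∷ rest))                    ≡⟨ flush-atop rβ (a ∷ rest) ⟩
        flush rβ ++ a ∷ rest                          ∎
    max-last : westSort (sσ (α ++ N ∷ β)) ≡ westSort (sσ (α ++ β)) ++ [ N ]
    max-last = begin
        westSort (sσ (α ++ N ∷ β))                            ≡⟨ westSort-τ′ ⟩
        (westSort Z ++ westSort (stack atN)) ++ [ N ]
          ≡⟨ cong₂ (λ z s → (westSort z ++ westSort s) ++ [ N ])
                   (cong₂ (λ o T → o ++ T ++ flush rβ) oα≡[] T≡[]) (stack-atN T≡[]) ⟩
        (westSort (flush rβ) ++ westSort (a ∷ rest)) ++ [ N ]
          ≡⟨ cong (_++ [ N ]) (sym (westSort-split (flush rβ) a rest (All-rβ β<a))) ⟩
        westSort (flush rβ ++ a ∷ rest) ++ [ N ]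
          ≡⟨ cong (λ l → westSort l ++ [ N ]) (sym sσ-τ) ⟩
        westSort (sσ (α ++ β)) ++ [ N ]
        ∎

  -- 𝔰 outputs Z N S, so s outputs s(Z) s(S) N and sortability forces Z < S. The minimum of α is
  -- never popped, so it lies in S, and no entry of α can be popped before the input ends; then a,
  -- on top of S, was not popped by N, so it is the minimum of α, and β ⊆ Z lies below it.
  sortable⇒quiet : Sortable N (α ++ N ∷ β) →
    Separator α₀ a β × Quiet N (α ++ β) (α ++ N ∷ β)
  sortable⇒quiet sorted = (a≤α₀ , β<a) , nothing-popped⇒quiet oα≡[] T≡[] β<a
    where
    split : westSort Z ++ westSort (stack atN) ≡ idPerm n
    split = ∷ʳ-injectiveˡ _ _ (trans (sym westSort-τ′) (trans sorted (idPerm-suc n)))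
    ∈-westSort : ∀ {y L} → y ∈ L → y ∈ westSort L
    ∈-westSort {L = L} = ∈-resp-↭ (↭-sym (westSort-↭ L))
    Z<S : ∀ {s} → s ∈ stack atN → All (_< s) Z
    Z<S s∈ = All.tabulate λ z∈ →
      AllPairs-++-across (subst (AllPairs _<_) (sym split) (idPerm-increasing n))
                         (∈-westSort z∈) (∈-westSort s∈)
    μ : ℕ
    μ = min a α
    μ≤α : All (μ ≤_) α
    μ≤α = min≤xs a α
    μ∈α : μ ∈ α
    μ∈α with argmin-sel (λ x → x) a α
    ... | inj₁ μ≡a = subst (_∈ α) (sym μ≡a) a∈α
    ... | inj₂ μ∈  = μ∈
    Z<μ : All (_< μ) Z
    Z<μ = Z<S (pops-keeps-min N (stack rα) (run-keeps-min [] α μ∈α μ≤α)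
                              (++⁻ʳ (output rα) (All-flush-run σ [] α μ≤α)))
    oα≡[] : output rα ≡ []
    oα≡[] = ≥∧<⇒[] (proj₁ (All-α μ≤α)) (++⁻ˡ (output rα) Z<μ)
    T≡[] : output atN ≡ []
    T≡[] = ≥∧<⇒[] (proj₁ (proj₂ (All-α μ≤α)))
                  (++⁻ˡ (output atN) (++⁻ʳ (output rα) Z<μ))
    a-stays : σ a rest N ≡ false
    a-stays = pops-none-top σ N a rest (subst (λ st → output (pops σ N st) ≡ []) stack-rα T≡[])
    a≤rest : All (a ≤_) rest
    a≤rest = any-<ᵇ≡false⇒≥ a rest
               (subst (λ b → b ∧ any (_<ᵇ a) rest ≡ false)
                      (<ᵇ-true (All.lookup α<N a∈α)) a-stays)
    rest↭α₀ : rest ↭ α₀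
    rest↭α₀ = drop-∷ (↭-trans (↭-reflexive (sym stack-rα))
                      (↭-trans (subst (_↭ α) (cong (_++ stack rα) oα≡[]) (run-↭ σ [] α))
                               (↭-sym (∷↭∷ʳ a α₀))))
    a≤α₀ : All (a ≤_) α₀
    a≤α₀ = All-resp-↭ rest↭α₀ a≤rest
    β<a : All (_< a) β
    β<a = All-resp-↭ (run-↭ (avoidRule (stack atN)) [] β)
            (++⁻ʳ (output atN) (++⁻ʳ (output rα)
              (Z<S (subst (a ∈_) (sym (stack-atN T≡[])) (here refl)))))

  separator⇒quiet : Separator α₀ a β → PopFree (α ++ β) → Quiet N (α ++ β) (α ++ N ∷ β)
  separator⇒quiet (a≤α₀ , β<a) popFree = nothing-popped⇒quiet oα≡[] T≡[] β<a
    where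
    oα≡[] : output rα ≡ []
    oα≡[] = ++-conicalˡ (output rα) _ (trans (sym (cong output (run-++ σ [] α β))) popFree)
    a≤rest : All (a ≤_) rest
    a≤rest = All.tail (subst (All (a ≤_)) stack-rα
                        (++⁻ʳ (output rα) (All-flush-run σ [] α (∷ʳ⁺ a≤α₀ ≤-refl))))
    T≡[] : output atN ≡ []
    T≡[] = subst (λ st → output (pops σ N st) ≡ []) (sym stack-rα)
                 (pops-stop σ N a rest (σ-keeps-min N a≤rest))

-- That sortable permutations are pop-free is needed to insert a maximum after a separator, and is
-- itself proved along these insertions.
Invariant : ℕ → List ℕ → Set
Invariant n τ = All (_< suc n) τ × (Sortable n τ → PopFree τ)

sortable-after⇔ : ∀ n α₀ a β → Invariant n ((α₀ ∷ʳ a) ++ β) →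
  Sortable (suc n) ((α₀ ∷ʳ a) ++ suc n ∷ β) ⇔
  (Sortable n ((α₀ ∷ʳ a) ++ β) × Separator α₀ a β)
sortable-after⇔ n α₀ a β (τ<N , popFree) = mk⇔
  (λ sorted′ → let (separated , q) = sortable⇒quiet sorted′ in
     Equivalence.to (quiet-sortable q) sorted′ , separated)
  (λ (sorted , separated) →
     Equivalence.from (quiet-sortable (separator⇒quiet separated (popFree sorted))) sorted)
  where open InsertAfter n α₀ a β (++⁻ˡ (α₀ ∷ʳ a) τ<N) (++⁻ʳ (α₀ ∷ʳ a) τ<N)

sortable-child⇒quiet : ∀ n α β → All (_< suc n) (α ++ β) →
  Sortable (suc n) (α ++ suc n ∷ β) → Quiet (suc n) (α ++ β) (α ++ suc n ∷ β)
sortable-child⇒quiet n α β τ<N with initLast α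
... | []       = λ _ → quiet-front (suc n) β τ<N
... | α₀ ∷ʳ′ a = λ sorted′ → proj₂ (sortable⇒quiet sorted′)
  where open InsertAfter n α₀ a β (++⁻ˡ (α₀ ∷ʳ a) τ<N) (++⁻ʳ (α₀ ∷ʳ a) τ<N)

invariant-child : ∀ n α β → Invariant n (α ++ β) → Invariant (suc n) (α ++ suc n ∷ β)
invariant-child n α β (τ<N , popFree) =
  ++⁺ (All.map m<n⇒m<1+n (++⁻ˡ α τ<N)) (≤-refl ∷ All.map m<n⇒m<1+n (++⁻ʳ α τ<N)) ,
  λ sorted′ → let q = sortable-child⇒quiet n α β τ<N sorted′ in
    quiet-popFree q (popFree (Equivalence.to (quiet-sortable q) sorted′))

All-insertEverywhere : ∀ {P : List ℕ → Set} N τ →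
  (∀ α β → α ++ β ≡ τ → P (α ++ N ∷ β)) → All P (insertEverywhere N τ)
All-insertEverywhere N []       h = h [] [] refl ∷ []
All-insertEverywhere N (y ∷ ys) h =
  h [] (y ∷ ys) refl ∷
  map⁺ (All-insertEverywhere N ys (λ α β eq → h (y ∷ α) β (cong (y ∷_) eq)))

invariant-perms : ∀ n → All (Invariant n) (perms n)
invariant-perms zero    = ([] , λ _ → refl) ∷ []
invariant-perms (suc n) = concat⁺ (map⁺ (All.map children-invariant (invariant-perms n)))
  where
  children-invariant : ∀ {τ} → Invariant n τ → All (Invariant (suc n)) (insertEverywhere (suc n) τ)
  children-invariant {τ} inv = All-insertEverywhere (suc n) τ
    (λ α β eq → invariant-child n α β (subst (Invariant n) (sym eq) inv))

-- Counting

sortable? : ∀ n τ → Dec (Sortable n τ)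
sortable? n τ = ≡-dec _≟_ (westSort (sσ τ)) (idPerm n)

separator? : ∀ pre a post → Dec (Separator pre a post)
separator? pre a post = All.all? (a ≤?_) pre ×-dec All.all? (_<? a) post

separatorsIn : List ℕ → List ℕ → ℕ
separatorsIn pre []         = 0
separatorsIn pre (b ∷ post) =
  (if does (separator? pre b post) then 1 else 0) + separatorsIn (pre ∷ʳ b) post

label : List ℕ → ℕ
label τ = separatorsIn [] τ

separatorsIn-drop-max : ∀ {N} P Q post → All (_≤ N) post →
  separatorsIn (P ++ N ∷ Q) post ≡ separatorsIn (P ++ Q) post
separatorsIn-drop-max     P Q []         _              = refl
separatorsIn-drop-max {N} P Q (b ∷ post) (b≤N ∷ post≤N) = cong₂ _+_
  (cong (λ c → if c then 1 else 0) (does-⇔ same-separator (separator? _ b post) (separator? _ b post)))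
  (begin
    separatorsIn ((P ++ N ∷ Q) ∷ʳ b) post ≡⟨ cong (λ l → separatorsIn l post) (++-assoc P _ [ b ]) ⟩
    separatorsIn (P ++ N ∷ (Q ∷ʳ b)) post ≡⟨ separatorsIn-drop-max P (Q ∷ʳ b) post post≤N ⟩
    separatorsIn (P ++ Q ∷ʳ b) post       ≡⟨ cong (λ l → separatorsIn l post) (sym (++-assoc P Q [ b ])) ⟩
    separatorsIn ((P ++ Q) ∷ʳ b) post     ∎)
  where
  open ≡-Reasoning
  same-separator : Separator (P ++ N ∷ Q) b post ⇔ Separator (P ++ Q) b post
  same-separator = mk⇔
    (λ (b≤pre , post<b) → ++⁺ (++⁻ˡ P b≤pre) (All.tail (++⁻ʳ P b≤pre)) , post<b)
    (λ (b≤pre , post<b) → ++⁺ (++⁻ˡ P b≤pre) (b≤N ∷ ++⁻ʳ P b≤pre) , post<b)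

label-front : ∀ N β → All (_< N) β → label (N ∷ β) ≡ suc (label β)
label-front N β β<N rewrite dec-true (separator? [] N β) ([] , β<N) =
  cong suc (separatorsIn-drop-max [] [] β (All.map <⇒≤ β<N))

separatorsIn-around-max : ∀ {N} pre xs β → Any (_< N) (pre ++ xs) → All (_< N) xs → All (_< N) β →
  separatorsIn pre (xs ++ N ∷ β) ≡ separatorsIn (pre ++ xs) β
separatorsIn-around-max {N} pre [] β small _ β<N
  rewrite dec-false (separator? pre N β)
            (λ (N≤pre , _) → All¬⇒¬Any (All.map ≤⇒≯ N≤pre)
                                       (subst (Any (_< N)) (++-identityʳ pre) small)) =
  separatorsIn-drop-max pre [] β (All.map <⇒≤ β<N)
separatorsIn-around-max {N} pre (x ∷ xs) β small (x<N ∷ xs<N) β<N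
  rewrite dec-false (separator? pre x (xs ++ N ∷ β))
            (λ (_ , after<x) → <⇒≯ x<N (All.lookup after<x (∈-++⁺ʳ xs (here refl)))) =
  trans (separatorsIn-around-max (pre ∷ʳ x) xs β
           (subst (Any (_< N)) (sym (++-assoc pre [ x ] xs)) small) xs<N β<N)
        (cong (λ l → separatorsIn l β) (++-assoc pre [ x ] xs))

-- Via the generating tree, the number of sortable permutations of length n + d obtained from τ
-- by inserting n + 1, n + 2, …, n + d.
descendants : ℕ → ℕ → List ℕ → ℕ
descendants n d τ = if does (sortable? n τ) then risingPaths (label τ) 0 d else 0

descendants-front : ∀ n d τ → All (_< suc n) τ →
  descendants (suc n) d (suc n ∷ τ) ≡
  (if does (sortable? n τ) then risingPaths (suc (label τ)) 0 d else 0)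
descendants-front n d τ τ<N
  rewrite does-⇔ (quiet-sortable (quiet-front (suc n) τ τ<N))
                 (sortable? (suc n) (suc n ∷ τ)) (sortable? n τ)
        | label-front (suc n) τ τ<N = refl

descendants-after : ∀ n d {τ} α₀ a β → (α₀ ∷ʳ a) ++ β ≡ τ → Invariant n τ →
  descendants (suc n) d ((α₀ ∷ʳ a) ++ suc n ∷ β) ≡
  (if does (sortable? n τ) ∧ does (separator? α₀ a β)
   then risingPaths (separatorsIn (α₀ ∷ʳ a) β) 0 d else 0)
descendants-after n d α₀ a β refl inv@(τ<N , _)
  rewrite does-⇔ (sortable-after⇔ n α₀ a β inv)
                 (sortable? (suc n) ((α₀ ∷ʳ a) ++ suc n ∷ β))
                 (sortable? n ((α₀ ∷ʳ a) ++ β) ×-dec separator? α₀ a β)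
        | separatorsIn-around-max [] (α₀ ∷ʳ a) β
            (Any.++⁺ʳ α₀ (here (All.lookup τ<N (∈-++⁺ˡ (∈-++⁺ʳ α₀ (here refl))))))
            (++⁻ˡ (α₀ ∷ʳ a) τ<N) (++⁻ʳ (α₀ ∷ʳ a) τ<N) = refl

tree-step : ∀ s c k (f : ℕ → ℕ) →
  (if s ∧ c then f k else 0) + (if s then sumBelow k f else 0) ≡
  (if s then sumBelow ((if c then 1 else 0) + k) f else 0)
tree-step false c     k f = refl
tree-step true  true  k f = +-comm (f k) (sumBelow k f)
tree-step true  false k f = refl

laterInsertions : ℕ → List ℕ → List (List ℕ)
laterInsertions N []       = []
laterInsertions N (y ∷ ys) = map (y ∷_) (insertEverywhere N ys)

insertEverywhere-split : ∀ N β → insertEverywhere N β ≡ (N ∷ β) ∷ laterInsertions N β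
insertEverywhere-split N []      = refl
insertEverywhere-split N (_ ∷ _) = refl

module _ (n d : ℕ) {τ : List ℕ} (inv : Invariant n τ) where

  private
    N : ℕ
    N = suc n
    s : Bool
    s = does (sortable? n τ)
    R : ℕ → ℕ
    R j = risingPaths j 0 d

  sum-children-after : ∀ α₀ a β → (α₀ ∷ʳ a) ++ β ≡ τ →
    sum (map (λ γ → descendants N d ((α₀ ∷ʳ a) ++ γ)) (insertEverywhere N β)) ≡
    (if s then sumBelow (separatorsIn α₀ (a ∷ β)) R else 0)
  sum-later-children : ∀ α β → α ++ β ≡ τ →
    sum (map (λ γ → descendants N d (α ++ γ)) (laterInsertions N β)) ≡
    (if s then sumBelow (separatorsIn α β) R else 0)

  sum-children-after α₀ a β eq = begin
      sum (map child (insertEverywhere N β))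
    ≡⟨ cong (λ l → sum (map child l)) (insertEverywhere-split N β) ⟩
      descendants N d (α ++ N ∷ β) + sum (map child (laterInsertions N β))
    ≡⟨ cong₂ _+_ (descendants-after n d α₀ a β eq inv) (sum-later-children α β eq) ⟩
      (if s ∧ separated then R (separatorsIn α β) else 0) +
      (if s then sumBelow (separatorsIn α β) R else 0)
    ≡⟨ tree-step s separated (separatorsIn α β) R ⟩
      (if s then sumBelow (separatorsIn α₀ (a ∷ β)) R else 0)
    ∎
    where
    open ≡-Reasoning
    α : List ℕ
    α = α₀ ∷ʳ a
    child : List ℕ → ℕ
    child γ = descendants N d (α ++ γ)
    separated : Bool
    separated = does (separator? α₀ a β)

  sum-later-children α []      _  = sym (if-eta s)
  sum-later-children α (b ∷ β) eq =
    trans (cong sum (trans (sym (map-∘ (insertEverywhere N β)))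
                           (map-cong (λ γ → cong (descendants N d) (sym (++-assoc α [ b ] γ)))
                                     (insertEverywhere N β))))
          (sum-children-after α b β (trans (++-assoc α [ b ] β) eq))

  sum-children : sum (map (descendants N d) (insertEverywhere N τ)) ≡ descendants n (suc d) τ
  sum-children = begin
      sum (map (descendants N d) (insertEverywhere N τ))
    ≡⟨ cong (λ l → sum (map (descendants N d) l)) (insertEverywhere-split N τ) ⟩
      descendants N d (N ∷ τ) + sum (map (descendants N d) (laterInsertions N τ))
    ≡⟨ cong₂ _+_ (descendants-front n d τ (proj₁ inv)) (sum-later-children [] τ refl) ⟩
      (if s then R (suc (label τ)) else 0) + (if s then sumBelow (label τ) R else 0)
    ≡⟨ root s ⟩
      descendants n (suc d) τ
    ∎
    where
    open ≡-Reasoning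
    root : ∀ b → (if b then R (suc (label τ)) else 0) + (if b then sumBelow (label τ) R else 0) ≡
                 (if b then risingPaths (label τ) 0 (suc d) else 0)
    root false = refl
    root true  = sym (risingPaths-children (label τ) d)

total : ℕ → ℕ → ℕ
total n d = sum (map (descendants n d) (perms n))

sum-map-concat : ∀ {A : Set} (f : A → ℕ) xss →
  sum (map f (concat xss)) ≡ sum (map (λ xs → sum (map f xs)) xss)
sum-map-concat f []         = refl
sum-map-concat f (xs ∷ xss) =
  trans (cong sum (map-++ f xs (concat xss)))
        (trans (sum-++ (map f xs) _) (cong (sum (map f xs) +_) (sum-map-concat f xss)))

total-suc : ∀ n d → total (suc n) d ≡ total n (suc d)
total-suc n d = begin
    sum (map (descendants (suc n) d) (concat (map (insertEverywhere (suc n)) (perms n))))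
  ≡⟨ sum-map-concat (descendants (suc n) d) (map (insertEverywhere (suc n)) (perms n)) ⟩
    sum (map (λ xs → sum (map (descendants (suc n) d) xs)) (map (insertEverywhere (suc n)) (perms n)))
  ≡⟨ cong sum (sym (map-∘ (perms n))) ⟩
    sum (map (λ τ → sum (map (descendants (suc n) d) (insertEverywhere (suc n) τ))) (perms n))
  ≡⟨ cong sum (map-cong-local (All.map (λ inv → sum-children n d inv) (invariant-perms n))) ⟩
    total n (suc d)
  ∎
  where open ≡-Reasoning

total-depth : ∀ n d → total n d ≡ pathsFrom (n + d) 0
total-depth zero    d = +-identityʳ (pathsFrom d 0)
total-depth (suc n) d =
  trans (total-suc n d) (trans (total-depth n (suc d)) (cong (λ m → pathsFrom m 0) (+-suc n d)))

length-filter : ∀ {A : Set} {P : A → Set} (P? : ∀ x → Dec (P x)) xs →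
  length (filter P? xs) ≡ sum (map (λ x → if does (P? x) then 1 else 0) xs)
length-filter P? []       = refl
length-filter P? (x ∷ xs) with does (P? x)
... | true  = cong suc (length-filter P? xs)
... | false = length-filter P? xs

length-Sortσ : ∀ n → length (Sortσ n) ≡ total n 0
length-Sortσ n = trans (length-filter (sortable? n) (perms n)) (cong sum (map-cong one (perms n)))
  where
  one : ∀ τ → (if does (sortable? n τ) then 1 else 0) ≡ descendants n 0 τ
  one τ = cong (λ k → if does (sortable? n τ) then k else 0) (sym (risingPaths-empty (label τ)))

mainTheorem18 : (n : ℕ) → 1 ≤ n → length (Sortσ n) ≡ motzkin n
mainTheorem18 n _ = begin
  length (Sortσ n)    ≡⟨ length-Sortσ n ⟩
  total n 0           ≡⟨ total-depth n 0 ⟩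
  pathsFrom (n + 0) 0 ≡⟨ cong (λ m → pathsFrom m 0) (+-identityʳ n) ⟩
  motzkin n           ∎
  where open ≡-Reasoning
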